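{- Let $k\ge 1$ and let $P=p_1p_2\cdots p_k$ and $Q=q_1q_2\cdots q_k$ be alternating permutations in $A_k$. For $n\ge k$ let $A^{P}(n)$ be the set of alternating permutations $\sigma\in A_n$ whose prefix $\sigma_1\sigma_2\cdots\sigma_k$ is order-isomorphic to $P$, and let $f^{P}(x)=\sum_{n\ge k}|A^{P}(n)|\,\frac{x^n}{n!}$, and similarly $f^{Q}$. If $p_k=q_k$, then $f^{P}=f^{Q}$, i.e. $|A^{P}(n)|=|A^{Q}(n)|$ for all $n\ge k$.
   Context: A permutation $\sigma=\sigma_1\cdots\sigma_n$ of $\{1,\dots,n\}$ is alternating (up-down) if $\sigma_1<\sigma_2>\sigma_3<\sigma_4>\cdots$; $A_n$ denotes the set of alternating permutations of length $n$. A sequence of distinct integers is order-isomorphic to a permutation $P$ of the same length if its entries are in the same relative order as the entries of $P$. -}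

module Defs where

open import Data.Nat using (ℕ; zero; suc; _≤_; _<_)
open import Data.Fin using (Fin; toℕ)
open import Data.Vec using (Vec; []; _∷_; take; lookup; allFin)
open import Data.List using (List; []; _∷_; length; filter; concatMap; map)
open import Data.Product using (_×_)
open import Relation.Nullary using (Dec; ¬_)
open import Relation.Unary using (Decidable)
open import Relation.Binary.PropositionalEquality using (_≡_)
import Data.Fin as F

-- A permutation of {1..n} is represented (0-indexed) as its one-line
-- notation: a vector σ of length n with entries in Fin n, pairwise distinct.
IsPerm : ∀ {n} → Vec (Fin n) n → Set
IsPerm {n} σ = ∀ (i j : Fin n) → lookup σ i ≡ lookup σ j → i ≡ j

data UpFrom : List ℕ → Set
data DownFrom : List ℕ → Set
data UpFrom where
  u[]  : UpFrom []
  u[x] : ∀ x → UpFrom (x ∷ [])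
  u∷   : ∀ x y {l} → x < y → DownFrom (y ∷ l) → UpFrom (x ∷ y ∷ l)
data DownFrom where
  d[]  : DownFrom []
  d[x] : ∀ x → DownFrom (x ∷ [])
  d∷   : ∀ x y {l} → y < x → UpFrom (y ∷ l) → DownFrom (x ∷ y ∷ l)

Alternating : List ℕ → Set
Alternating = UpFrom

toList-ℕ : ∀ {m n} → Vec (Fin m) n → List ℕ
toList-ℕ [] = []
toList-ℕ (x ∷ v) = toℕ x ∷ toList-ℕ v

IsAlternatingPerm : ∀ {n} → Vec (Fin n) n → Set
IsAlternatingPerm σ = IsPerm σ × Alternating (toList-ℕ σ)

OrderIso : ∀ {a b k} → Vec (Fin a) k → Vec (Fin b) k → Set
OrderIso {k = k} u v =
  ∀ (i j : Fin k) → (toℕ (lookup u i) < toℕ (lookup u j)) → (toℕ (lookup v i) < toℕ (lookup v j))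

OrderIsomorphic : ∀ {a b k} → Vec (Fin a) k → Vec (Fin b) k → Set
OrderIsomorphic u v = OrderIso u v × OrderIso v u

allVecs : ∀ (n k : ℕ) → List (Vec (Fin n) k)
allVecs n zero = [] ∷ []
allVecs n (suc k) = concatMap (λ x → map (x ∷_) (allVecs n k)) (Data.Vec.toList (allFin n))

prefix : ∀ {n} k m → Vec (Fin n) (k Data.Nat.+ m) → Vec (Fin n) k
prefix k m σ = take k σ

InAP : ∀ {k} (P : Vec (Fin k) k) (m : ℕ) → Vec (Fin (k Data.Nat.+ m)) (k Data.Nat.+ m) → Set
InAP {k} P m σ = IsAlternatingPerm σ × OrderIsomorphic (prefix k m σ) P

-- |A^P(n)|, given a decision procedure for membership (the theorem
-- quantifies over any such decider, so the count is the true cardinality).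
countBy : ∀ {A : Set} {p} {Pr : A → Set p} → Decidable Pr → List A → ℕ
countBy d xs = length (filter d xs)

cardAP : ∀ {k} (P : Vec (Fin k) k) (m : ℕ) → Decidable (InAP P m) → ℕ
cardAP {k} P m d = countBy d (allVecs (k Data.Nat.+ m) (k Data.Nat.+ m))

-- For σ ∈ A^P(n), permute its first k positions by π = P⁻¹ ∘ Q, i.e. replace σ by σ ∘ (π ⊕ id).
-- The new prefix is order-isomorphic to P ∘ π = Q, hence alternating. Since p_k = q_k, π fixes
-- position k, so positions k, …, n are untouched and every comparison from σ_k on (including
-- σ_k against σ_{k+1}) is unchanged. The inverse map is built from π⁻¹ in the same way, so this
-- is a bijection A^P(n) → A^Q(n).
module Submission where

open import Defs
open import Data.Bool using (Bool; true; false; not)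
open import Data.Fin using (Fin; toℕ; fromℕ; _↑ˡ_; splitAt; join; punchOut)
import Data.Fin as Fin
open import Data.Fin.Permutation
  using (Permutation′; permutation; _⟨$⟩ʳ_; _⟨$⟩ˡ_; inverseˡ; inverseʳ; flip; _∘ₚ_)
open import Data.Fin.Properties
  using (any?; punchOut-injective; injective⇒≤; toℕ-injective; toℕ-↑ˡ; toℕ-fromℕ; toℕ≤pred[n];
         toℕ-inject≤; splitAt-join; join-splitAt; splitAt-↑ˡ; splitAt-<; splitAt⁻¹-↑ˡ; splitAt⁻¹-↑ʳ)
  renaming (_≟_ to _≟ᶠ_)
open import Data.List using (List; []; _∷_; _++_; length; filter; map; concatMap; cartesianProductWith)
import Data.List as List
open import Data.List.Membership.Propositional using (_∈_)
open import Data.List.Membership.Propositional.Properties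
  using (∈-filter⁺; ∈-filter⁻; ∈-map⁺; ∈-map⁻; ∈-cartesianProductWith⁺; ∈-allFin)
open import Data.List.Membership.Propositional.Properties.WithK using (unique∧set⇒bag)
open import Data.List.Properties using (length-map)
open import Data.List.Relation.Binary.BagAndSetEquality using (∼bag⇒↭)
open import Data.List.Relation.Binary.Permutation.Propositional using (_↭_)
open import Data.List.Relation.Binary.Permutation.Propositional.Properties using (↭-length)
import Data.List.Relation.Unary.All as All
import Data.List.Relation.Unary.AllPairs as AllPairs
open import Data.List.Relation.Unary.Any using (here)
open import Data.List.Relation.Unary.Unique.Propositional using (Unique)
import Data.List.Relation.Unary.Unique.Propositional.Properties as Unique
open import Data.Nat using (ℕ; zero; suc; _+_; _≤_; _<_; _≤?_; s≤s)
open import Data.Nat.Properties using (1+n≰n; ≤-antisym; ≤-trans; ≤-reflexive; n≤1+n; ≰⇒>; suc-injective)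
open import Data.Product using (∃; _×_; _,_; proj₁; proj₂)
open import Data.Sum using (_⊎_; inj₁; inj₂)
import Data.Sum as Sum
open import Data.Vec using (Vec; []; _∷_; lookup; tabulate; take)
import Data.Vec as Vec
open import Data.Vec.Properties
  using (∷-injective; lookup∘tabulate; tabulate∘lookup; tabulate-cong; lookup-take-inject≤)
open import Function using (_∘_; id; _↔_; mk↔ₛ′; mk⇔; Injective; Inverse; Injection)
open import Function.Properties.Inverse using (Inverse⇒Injection)
open import Relation.Binary.PropositionalEquality
  using (_≡_; _≢_; _≗_; refl; cong; sym; trans; subst; subst₂; module ≡-Reasoning)
open import Relation.Nullary using (yes; no; contradiction)
open import Relation.Unary using (Pred; Decidable)

countBy-↔ : ∀ {A : Set} {p q} {Pr : Pred A p} {Qr : Pred A q}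
  (dP : Decidable Pr) (dQ : Decidable Qr) {xs : List A} →
  Unique xs → (∀ x → x ∈ xs) → (e : A ↔ A) →
  (∀ {x} → Pr x → Qr (Inverse.to e x)) → (∀ {y} → Qr y → Pr (Inverse.from e y)) →
  countBy dP xs ≡ countBy dQ xs
countBy-↔ dP dQ {xs} unique complete e P⇒Q Q⇒P = begin
  length (filter dP xs)          ≡⟨ length-map to (filter dP xs) ⟨
  length (map to (filter dP xs)) ≡⟨ ↭-length image↭ ⟩
  length (filter dQ xs)          ∎
  where
  open ≡-Reasoning
  open Inverse e using (to; from; strictlyInverseˡ)
  image-unique : Unique (map to (filter dP xs))
  image-unique = Unique.map⁺ (Injection.injective (Inverse⇒Injection e)) (Unique.filter⁺ dP unique)
  image⊆ : ∀ {y} → y ∈ map to (filter dP xs) → y ∈ filter dQ xs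
  image⊆ y∈ with x , x∈ , refl ← ∈-map⁻ to y∈ =
    ∈-filter⁺ dQ (complete (to x)) (P⇒Q (proj₂ (∈-filter⁻ dP {xs = xs} x∈)))
  ⊆image : ∀ {y} → y ∈ filter dQ xs → y ∈ map to (filter dP xs)
  ⊆image {y} y∈ = subst (_∈ map to (filter dP xs)) (strictlyInverseˡ y)
    (∈-map⁺ to (∈-filter⁺ dP (complete (from y)) (Q⇒P (proj₂ (∈-filter⁻ dQ {xs = xs} y∈)))))
  image↭ : map to (filter dP xs) ↭ filter dQ xs
  image↭ = ∼bag⇒↭ (unique∧set⇒bag image-unique (Unique.filter⁺ dQ unique) (mk⇔ image⊆ ⊆image))

toList-tabulate : ∀ {A : Set} {n} (f : Fin n → A) → Vec.toList (tabulate f) ≡ List.tabulate f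
toList-tabulate {n = zero}  f = refl
toList-tabulate {n = suc n} f = cong (f Fin.zero ∷_) (toList-tabulate (f ∘ Fin.suc))

concatMap-map≡cartesianProductWith : ∀ {A B C : Set} (f : A → B → C) xs ys →
  concatMap (λ x → map (f x) ys) xs ≡ cartesianProductWith f xs ys
concatMap-map≡cartesianProductWith f []       ys = refl
concatMap-map≡cartesianProductWith f (x ∷ xs) ys =
  cong (map (f x) ys ++_) (concatMap-map≡cartesianProductWith f xs ys)

allVecs-suc : ∀ n k → allVecs n (suc k) ≡ cartesianProductWith _∷_ (List.allFin n) (allVecs n k)
allVecs-suc n k = trans (concatMap-map≡cartesianProductWith _∷_ (Vec.toList (Vec.allFin n)) (allVecs n k))
  (cong (λ xs → cartesianProductWith _∷_ xs (allVecs n k)) (toList-tabulate id))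

allVecs-complete : ∀ n k (v : Vec (Fin n) k) → v ∈ allVecs n k
allVecs-complete n zero    []      = here refl
allVecs-complete n (suc k) (x ∷ v) rewrite allVecs-suc n k =
  ∈-cartesianProductWith⁺ _∷_ (∈-allFin x) (allVecs-complete n k v)

allVecs-unique : ∀ n k → Unique (allVecs n k)
allVecs-unique n zero    = All.[] AllPairs.∷ AllPairs.[]
allVecs-unique n (suc k) rewrite allVecs-suc n k =
  Unique.cartesianProductWith⁺ _∷_ ∷-injective (Unique.allFin⁺ n) (allVecs-unique n k)

injective⇒surjective : ∀ {n} {f : Fin n → Fin n} → Injective _≡_ _≡_ f → ∀ y → ∃ λ x → f x ≡ y
injective⇒surjective {suc n} {f} f-inj y with any? (λ x → f x ≟ᶠ y)
... | yes found = found
... | no ¬found = contradiction (injective⇒≤ punchOut∘f-injective) 1+n≰n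
  where
  y≢f : ∀ x → y ≢ f x
  y≢f x e = ¬found (x , sym e)
  punchOut∘f-injective : Injective _≡_ _≡_ (λ x → punchOut (y≢f x))
  punchOut∘f-injective {a} {b} = f-inj ∘ punchOut-injective (y≢f a) (y≢f b)

fromInjective : ∀ {n} {f : Fin n → Fin n} → Injective _≡_ _≡_ f → Permutation′ n
fromInjective {n} {f} f-inj = permutation f (proj₁ ∘ surj) (proj₂ ∘ surj) (λ x → f-inj (proj₂ (surj (f x))))
  where
  surj : ∀ y → ∃ λ x → f x ≡ y
  surj = injective⇒surjective f-inj

map↑ˡ : ∀ {k} m → (Fin k → Fin k) → Fin (k + m) → Fin (k + m)
map↑ˡ {k} m h = join k m ∘ Sum.map₁ h ∘ splitAt k

map↑ˡ-inverse : ∀ {k} m {g h : Fin k → Fin k} → (∀ a → g (h a) ≡ a) →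
  ∀ x → map↑ˡ m g (map↑ˡ m h x) ≡ x
map↑ˡ-inverse {k} m {g} {h} gh x = begin
  join k m (Sum.map₁ g (splitAt k (join k m (Sum.map₁ h (splitAt k x)))))
    ≡⟨ cong (join k m ∘ Sum.map₁ g) (splitAt-join k m (Sum.map₁ h (splitAt k x))) ⟩
  join k m (Sum.map₁ g (Sum.map₁ h (splitAt k x)))
    ≡⟨ cong (join k m) (map₁-inverse (splitAt k x)) ⟩
  join k m (splitAt k x)
    ≡⟨ join-splitAt k m x ⟩
  x ∎
  where
  open ≡-Reasoning
  map₁-inverse : ∀ {B : Set} (s : Fin k ⊎ B) → Sum.map₁ g (Sum.map₁ h s) ≡ s
  map₁-inverse (inj₁ a) = cong inj₁ (gh a)
  map₁-inverse (inj₂ b) = refl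

extend : ∀ {k} m → Permutation′ k → Permutation′ (k + m)
extend m π = permutation (map↑ˡ m (π ⟨$⟩ʳ_)) (map↑ˡ m (π ⟨$⟩ˡ_))
  (map↑ˡ-inverse m (λ _ → inverseʳ π)) (map↑ˡ-inverse m (λ _ → inverseˡ π))

extend-↑ˡ : ∀ {k} m (π : Permutation′ k) a → extend m π ⟨$⟩ʳ (a ↑ˡ m) ≡ (π ⟨$⟩ʳ a) ↑ˡ m
extend-↑ˡ {k} m π a = cong (join k m ∘ Sum.map₁ (π ⟨$⟩ʳ_)) (splitAt-↑ˡ k a m)

extend-fixes-≥ : ∀ {j} m (π : Permutation′ (suc j)) → π ⟨$⟩ʳ fromℕ j ≡ fromℕ j →
  ∀ x → j ≤ toℕ x → extend m π ⟨$⟩ʳ x ≡ x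
extend-fixes-≥ {j} m π fixes x j≤x with splitAt (suc j) x in eq
... | inj₂ b = splitAt⁻¹-↑ʳ eq
... | inj₁ a = trans (cong (_↑ˡ m) π-fixes-a) (splitAt⁻¹-↑ˡ eq)
  where
  j≤a : j ≤ toℕ a
  j≤a = ≤-trans j≤x (≤-reflexive (trans (cong toℕ (sym (splitAt⁻¹-↑ˡ eq))) (toℕ-↑ˡ a m)))
  a≡last : a ≡ fromℕ j
  a≡last = toℕ-injective (trans (≤-antisym (toℕ≤pred[n] a) j≤a) (sym (toℕ-fromℕ j)))
  π-fixes-a : π ⟨$⟩ʳ a ≡ a
  π-fixes-a = subst (λ b → π ⟨$⟩ʳ b ≡ b) (sym a≡last) fixes

entry : ∀ {a n} → Vec (Fin a) n → Fin n → ℕ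
entry v = toℕ ∘ lookup v

lookup-take-↑ˡ : ∀ {A : Set} k {m} (v : Vec A (k + m)) a → lookup (take k v) a ≡ lookup v (a ↑ˡ m)
lookup-take-↑ˡ k {m} v a = trans (lookup-take-inject≤ v a)
  (cong (lookup v) (toℕ-injective (trans (toℕ-inject≤ a _) (sym (toℕ-↑ˡ a m)))))

reindex : ∀ {A : Set} {n} → (Fin n → Fin n) → Vec A n → Vec A n
reindex h σ = tabulate (lookup σ ∘ h)

lookup-reindex : ∀ {A : Set} {n} (h : Fin n → Fin n) (σ : Vec A n) i →
  lookup (reindex h σ) i ≡ lookup σ (h i)
lookup-reindex h σ = lookup∘tabulate (lookup σ ∘ h)

reindex-inverse : ∀ {A : Set} {n} {g h : Fin n → Fin n} → (∀ i → g (h i) ≡ i) →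
  ∀ (σ : Vec A n) → reindex h (reindex g σ) ≡ σ
reindex-inverse {g = g} {h} gh σ = trans
  (tabulate-cong (λ i → trans (lookup-reindex g σ (h i)) (cong (lookup σ) (gh i))))
  (tabulate∘lookup σ)

IsPerm-reindex : ∀ {n} {h : Fin n → Fin n} {σ : Vec (Fin n) n} →
  Injective _≡_ _≡_ h → IsPerm σ → IsPerm (reindex h σ)
IsPerm-reindex {h = h} {σ} h-inj σ-perm i i' e =
  h-inj (σ-perm (h i) (h i') (trans (sym (lookup-reindex h σ i)) (trans e (lookup-reindex h σ i'))))

rearrange : ∀ {A : Set} {n} → Permutation′ n → Vec A n ↔ Vec A n
rearrange τ = mk↔ₛ′ (reindex (τ ⟨$⟩ʳ_)) (reindex (τ ⟨$⟩ˡ_))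
  (reindex-inverse (λ _ → inverseˡ τ)) (reindex-inverse (λ _ → inverseʳ τ))

-- OrderIso u v unfolds to OrderPreserving (entry u) (entry v).
OrderPreserving : ∀ {k} → (Fin k → ℕ) → (Fin k → ℕ) → Set
OrderPreserving f g = ∀ i j → f i < f j → g i < g j

OrderPreserving-reindex : ∀ {k} {f g f′ g′ : Fin k → ℕ} (π : Fin k → Fin k) →
  f′ ≗ f ∘ π → g′ ≗ g ∘ π → OrderPreserving f g → OrderPreserving f′ g′
OrderPreserving-reindex π f′≗ g′≗ f≲g i j lt =
  subst₂ _<_ (sym (g′≗ i)) (sym (g′≗ j)) (f≲g (π i) (π j) (subst₂ _<_ (f′≗ i) (f′≗ j) lt))

Step : Bool → ℕ → ℕ → Set
Step true  x y = x < y
Step false x y = y < x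

ascentAt : Bool → ℕ → Bool
ascentAt b zero    = b
ascentAt b (suc i) = ascentAt (not b) i

Zigzag : ∀ {n} → Bool → (Fin n → ℕ) → Set
Zigzag b f = ∀ i i′ → toℕ i′ ≡ suc (toℕ i) → Step (ascentAt b (toℕ i)) (f i) (f i′)

AlternatingFrom : Bool → List ℕ → Set
AlternatingFrom true  = UpFrom
AlternatingFrom false = DownFrom

alternatingFrom-[] : ∀ b → AlternatingFrom b []
alternatingFrom-[] true  = u[]
alternatingFrom-[] false = d[]

alternatingFrom-[x] : ∀ b x → AlternatingFrom b (x ∷ [])
alternatingFrom-[x] true  = u[x]
alternatingFrom-[x] false = d[x]

alternatingFrom-∷ : ∀ b {x y l} →
  Step b x y → AlternatingFrom (not b) (y ∷ l) → AlternatingFrom b (x ∷ y ∷ l)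
alternatingFrom-∷ true  = u∷ _ _
alternatingFrom-∷ false = d∷ _ _

alternatingFrom-∷⁻ : ∀ b {x y l} →
  AlternatingFrom b (x ∷ y ∷ l) → Step b x y × AlternatingFrom (not b) (y ∷ l)
alternatingFrom-∷⁻ true  (u∷ _ _ x<y alt) = x<y , alt
alternatingFrom-∷⁻ false (d∷ _ _ y<x alt) = y<x , alt

alternatingFrom⇒zigzag : ∀ b {a n} (v : Vec (Fin a) n) →
  AlternatingFrom b (toList-ℕ v) → Zigzag b (entry v)
alternatingFrom⇒zigzag b (x ∷ y ∷ v) alt Fin.zero (Fin.suc Fin.zero) refl = proj₁ (alternatingFrom-∷⁻ b alt)
alternatingFrom⇒zigzag b (x ∷ y ∷ v) alt (Fin.suc i) (Fin.suc i′) e =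
  alternatingFrom⇒zigzag (not b) (y ∷ v) (proj₂ (alternatingFrom-∷⁻ b alt)) i i′ (suc-injective e)

zigzag⇒alternatingFrom : ∀ b {a n} (v : Vec (Fin a) n) →
  Zigzag b (entry v) → AlternatingFrom b (toList-ℕ v)
zigzag⇒alternatingFrom b []          _  = alternatingFrom-[] b
zigzag⇒alternatingFrom b (x ∷ [])    _  = alternatingFrom-[x] b (toℕ x)
zigzag⇒alternatingFrom b (x ∷ y ∷ v) zz = alternatingFrom-∷ b (zz Fin.zero (Fin.suc Fin.zero) refl)
  (zigzag⇒alternatingFrom (not b) (y ∷ v) (λ i i′ e → zz (Fin.suc i) (Fin.suc i′) (cong suc e)))

step-transport : ∀ b {k} {f g : Fin k → ℕ} → OrderPreserving f g →
  ∀ {i i′} → Step b (f i) (f i′) → Step b (g i) (g i′)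
step-transport true  f≲g = f≲g _ _
step-transport false f≲g = f≲g _ _

zigzag-transport : ∀ {b k} {f g : Fin k → ℕ} → OrderPreserving f g → Zigzag b f → Zigzag b g
zigzag-transport f≲g zz i i′ e = step-transport _ f≲g (zz i i′ e)

↑ˡ-view : ∀ {k} m (x : Fin (k + m)) → toℕ x < k → ∃ λ a → a ↑ˡ m ≡ x
↑ˡ-view {k} m x x<k = _ , splitAt⁻¹-↑ˡ (splitAt-< k x x<k)

zigzag-splice : ∀ {j m b} {f g : Fin (suc j + m) → ℕ} →
  Zigzag b (g ∘ (_↑ˡ m)) → Zigzag b f → (∀ x → j ≤ toℕ x → g x ≡ f x) → Zigzag b g
zigzag-splice {j} {m} {b} {g = g} zg zf agree i i′ i′≡ with j ≤? toℕ i
... | yes j≤i = subst₂ (Step _) (sym (agree i j≤i)) (sym (agree i′ j≤i′)) (zf i i′ i′≡)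
  where
  j≤i′ : j ≤ toℕ i′
  j≤i′ = ≤-trans j≤i (≤-trans (n≤1+n _) (≤-reflexive (sym i′≡)))
... | no j≰i with a , refl ← ↑ˡ-view _ i (≤-trans (≰⇒> j≰i) (n≤1+n _))
                | a′ , refl ← ↑ˡ-view _ i′ (subst (λ t → suc t ≤ suc j) (sym i′≡) (s≤s (≰⇒> j≰i)))
  = subst (λ t → Step (ascentAt b t) (g (a ↑ˡ m)) (g (a′ ↑ˡ m))) (sym (toℕ-↑ˡ a m))
      (zg a a′ (trans (sym (toℕ-↑ˡ a′ m)) (trans i′≡ (cong suc (toℕ-↑ˡ a m)))))

InAP-rearrange : ∀ {j} (P Q : Vec (Fin (suc j)) (suc j)) m (π : Permutation′ (suc j)) →
  π ⟨$⟩ʳ fromℕ j ≡ fromℕ j → (∀ a → lookup Q a ≡ lookup P (π ⟨$⟩ʳ a)) →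
  Alternating (toList-ℕ Q) →
  ∀ {σ} → InAP P m σ → InAP Q m (Inverse.to (rearrange (extend m π)) σ)
InAP-rearrange {j} P Q m π π-fixes-last Q≗P∘π altQ {σ} ((σ-perm , altσ) , σ≲P , P≲σ) =
  (IsPerm-reindex {σ = σ} τ-injective σ-perm , zigzag⇒alternatingFrom true σ′ zigzag) , σ′≲Q , Q≲σ′
  where
  k : ℕ
  k = suc j
  τ : Fin (k + m) → Fin (k + m)
  τ = extend m π ⟨$⟩ʳ_
  τ-injective : Injective _≡_ _≡_ τ
  τ-injective = Injection.injective (Inverse⇒Injection (extend m π))
  σ′ : Vec (Fin (k + m)) (k + m)
  σ′ = reindex τ σ
  entry-take : ∀ {n} (v : Vec (Fin n) (k + m)) a → entry (take k v) a ≡ entry v (a ↑ˡ m)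
  entry-take v a = cong toℕ (lookup-take-↑ˡ k v a)
  σ′-head : ∀ a → entry σ′ (a ↑ˡ m) ≡ entry σ ((π ⟨$⟩ʳ a) ↑ˡ m)
  σ′-head a = cong toℕ (trans (lookup-reindex τ σ (a ↑ˡ m)) (cong (lookup σ) (extend-↑ˡ m π a)))
  σ′-take : ∀ a → entry (take k σ′) a ≡ entry (take k σ) (π ⟨$⟩ʳ a)
  σ′-take a = trans (entry-take σ′ a) (trans (σ′-head a) (sym (entry-take σ _)))
  Q-entry : ∀ a → entry Q a ≡ entry P (π ⟨$⟩ʳ a)
  Q-entry a = cong toℕ (Q≗P∘π a)
  σ′≲Q : OrderPreserving (entry (take k σ′)) (entry Q)
  σ′≲Q = OrderPreserving-reindex (π ⟨$⟩ʳ_) σ′-take Q-entry σ≲P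
  Q≲σ′ : OrderPreserving (entry Q) (entry (take k σ′))
  Q≲σ′ = OrderPreserving-reindex (π ⟨$⟩ʳ_) Q-entry σ′-take P≲σ
  Q≲σ′-head : OrderPreserving (entry Q) (entry σ′ ∘ (_↑ˡ m))
  Q≲σ′-head = OrderPreserving-reindex id (λ _ → refl) (sym ∘ entry-take σ′) Q≲σ′
  σ′-agrees : ∀ x → j ≤ toℕ x → entry σ′ x ≡ entry σ x
  σ′-agrees x j≤x =
    cong toℕ (trans (lookup-reindex τ σ x) (cong (lookup σ) (extend-fixes-≥ m π π-fixes-last x j≤x)))
  zigzag : Zigzag true (entry σ′)
  zigzag = zigzag-splice {f = entry σ} (zigzag-transport Q≲σ′-head (alternatingFrom⇒zigzag true Q altQ))
                         (alternatingFrom⇒zigzag true σ altσ) σ′-agrees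

theorem1 : ∀ (j : ℕ) (P Q : Vec (Fin (suc j)) (suc j))
    → IsAlternatingPerm P → IsAlternatingPerm Q
    → lookup P (fromℕ j) ≡ lookup Q (fromℕ j)
    → ∀ (m : ℕ) (dP : Decidable (InAP P m)) (dQ : Decidable (InAP Q m))
    → cardAP P m dP ≡ cardAP Q m dQ
theorem1 j P Q (P-perm , altP) (Q-perm , altQ) last m dP dQ =
  countBy-↔ dP dQ (allVecs-unique n n) (allVecs-complete n n) (rearrange (extend m π))
    (InAP-rearrange P Q m π π-fixes-last Q≗P∘π altQ)
    (InAP-rearrange Q P m (flip π) π⁻¹-fixes-last P≗Q∘π⁻¹ altP)
  where
  n : ℕ
  n = suc j + m
  ρP ρQ : Permutation′ (suc j)
  ρP = fromInjective (λ {a} {b} → P-perm a b)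
  ρQ = fromInjective (λ {a} {b} → Q-perm a b)
  -- π a = P⁻¹ (Q a): _∘ₚ_ applies its left argument first.
  π : Permutation′ (suc j)
  π = ρQ ∘ₚ flip ρP
  Q≗P∘π : ∀ a → lookup Q a ≡ lookup P (π ⟨$⟩ʳ a)
  Q≗P∘π a = sym (inverseʳ ρP)
  π-fixes-last : π ⟨$⟩ʳ fromℕ j ≡ fromℕ j
  π-fixes-last = trans (cong (ρP ⟨$⟩ˡ_) (sym last)) (inverseˡ ρP)
  π⁻¹-fixes-last : π ⟨$⟩ˡ fromℕ j ≡ fromℕ j
  π⁻¹-fixes-last = trans (cong (π ⟨$⟩ˡ_) (sym π-fixes-last)) (inverseˡ π)
  P≗Q∘π⁻¹ : ∀ a → lookup P a ≡ lookup Q (π ⟨$⟩ˡ a)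
  P≗Q∘π⁻¹ a = trans (cong (lookup P) (sym (inverseʳ π))) (sym (Q≗P∘π _))
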